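{- Let $A=\begin{pmatrix} a & b \\ c & d \end{pmatrix}\in M_2(\mathbb{Z})$ with $bc\neq 0$. Then there exists a matrix $B=\begin{pmatrix} a_1 & b_1 \\ c_1 & 0 \end{pmatrix}\in M_2(\mathbb{Z})$ with $b_1c_1\neq 0$ and $\gcd(a_1,b_1,c_1)=1$ such that $C(A)=C(B)$.
   Context: For $M\in M_2(\mathbb{Z})$, $C(M)=\{N\in M_2(\mathbb{Z}): MN=NM\}$ denotes the set of integral $2\times 2$ matrices commuting with $M$. -}

module Defs where

open import Data.Integer using (ℤ; _+_; _*_)
open import Relation.Binary.PropositionalEquality using (_≡_)

record M₂ℤ : Set where
  constructor mat
  field
    e₁₁ e₁₂ e₂₁ e₂₂ : ℤ

open M₂ℤ public

_·_ : M₂ℤ → M₂ℤ → M₂ℤ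
M · N = mat (e₁₁ M * e₁₁ N + e₁₂ M * e₂₁ N) (e₁₁ M * e₁₂ N + e₁₂ M * e₂₂ N)
            (e₂₁ M * e₁₁ N + e₂₂ M * e₂₁ N) (e₂₁ M * e₁₂ N + e₂₂ M * e₂₂ N)

_∈C_ : M₂ℤ → M₂ℤ → Set
N ∈C M = M · N ≡ N · M

{-# OPTIONS --safe #-}
-- With g = gcd(a − d, b, c), which is nonzero because b ≠ 0, we have A = g·B + d·I where
-- B = (a₁ b₁ ; c₁ 0) is primitive and b₁c₁ ≠ 0.  Centralizers are ℤ-submodules containing I,
-- so C(B) ⊆ C(A); conversely AN − NA = g·(BN − NB), and g ≠ 0 cancels in M₂(ℤ).
module Submission where

open import Defs
open import Data.Integer using (ℤ; _*_; 0ℤ; 1ℤ)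
open import Data.Integer.GCD using (gcd)
open import Data.Product using (Σ; _×_)
open import Relation.Binary.PropositionalEquality using (_≡_; _≢_)

open import Data.Integer.Base using (+_; _+_; _-_; ∣_∣; NonZero; ≢-nonZero)
open import Data.Integer.Properties
  using (+-0-abelianGroup; *-comm; *-zeroʳ; *-cancelˡ-≡; *-identityʳ; abs-*; pos-*)
open import Algebra.Properties.AbelianGroup +-0-abelianGroup using (∙-cancelʳ)
open import Data.Integer.Divisibility.Signed using (_∣_; ∣ᵤ⇒∣; ∣-trans; quotient)
import Data.Integer.Divisibility.Signed as Signed
open import Data.Integer.GCD using (gcd[i,j]∣i; gcd[i,j]∣j; gcd[i,j]≡0⇒i≡0; gcd[i,j]≡0⇒j≡0)
import Data.Nat.Base as ℕ
import Data.Nat.GCD as ℕ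
open import Data.Integer.Tactic.RingSolver using (solve-∀)
open import Data.Product using (_,_)
open import Relation.Binary.PropositionalEquality using (refl; sym; trans; cong; cong₂; subst; module ≡-Reasoning)

infixl 6 _⊞_
infixr 7 _⊛_

_⊞_ : M₂ℤ → M₂ℤ → M₂ℤ
M ⊞ N = mat (e₁₁ M + e₁₁ N) (e₁₂ M + e₁₂ N) (e₂₁ M + e₂₁ N) (e₂₂ M + e₂₂ N)

_⊛_ : ℤ → M₂ℤ → M₂ℤ
k ⊛ M = mat (k * e₁₁ M) (k * e₁₂ M) (k * e₂₁ M) (k * e₂₂ M)

𝟙 : M₂ℤ
𝟙 = mat 1ℤ 0ℤ 0ℤ 1ℤ

mat-cong : ∀ {a b c d a′ b′ c′ d′} → a ≡ a′ → b ≡ b′ → c ≡ c′ → d ≡ d′ → mat a b c d ≡ mat a′ b′ c′ d′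
mat-cong refl refl refl refl = refl

⊞-cancelʳ : ∀ M N P → M ⊞ P ≡ N ⊞ P → M ≡ N
⊞-cancelʳ M N P eq = mat-cong
  (∙-cancelʳ (e₁₁ P) (e₁₁ M) (e₁₁ N) (cong e₁₁ eq)) (∙-cancelʳ (e₁₂ P) (e₁₂ M) (e₁₂ N) (cong e₁₂ eq))
  (∙-cancelʳ (e₂₁ P) (e₂₁ M) (e₂₁ N) (cong e₂₁ eq)) (∙-cancelʳ (e₂₂ P) (e₂₂ M) (e₂₂ N) (cong e₂₂ eq))

⊛-cancelˡ : ∀ k M N .{{_ : NonZero k}} → k ⊛ M ≡ k ⊛ N → M ≡ N
⊛-cancelˡ k M N eq = mat-cong
  (*-cancelˡ-≡ k _ _ (cong e₁₁ eq)) (*-cancelˡ-≡ k _ _ (cong e₁₂ eq))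
  (*-cancelˡ-≡ k _ _ (cong e₂₁ eq)) (*-cancelˡ-≡ k _ _ (cong e₂₂ eq))

·-lincombʳ : ∀ k M l P N → (k ⊛ M ⊞ l ⊛ P) · N ≡ k ⊛ (M · N) ⊞ l ⊛ (P · N)
·-lincombʳ k (mat m₁₁ m₁₂ m₂₁ m₂₂) l (mat p₁₁ p₁₂ p₂₁ p₂₂) (mat n₁₁ n₁₂ n₂₁ n₂₂) = mat-cong
  (bilinear k l m₁₁ m₁₂ p₁₁ p₁₂ n₁₁ n₂₁) (bilinear k l m₁₁ m₁₂ p₁₁ p₁₂ n₁₂ n₂₂)
  (bilinear k l m₂₁ m₂₂ p₂₁ p₂₂ n₁₁ n₂₁) (bilinear k l m₂₁ m₂₂ p₂₁ p₂₂ n₁₂ n₂₂)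
  where
  bilinear : ∀ k l m m′ p p′ n n′ →
    (k * m + l * p) * n + (k * m′ + l * p′) * n′ ≡ k * (m * n + m′ * n′) + l * (p * n + p′ * n′)
  bilinear = solve-∀

·-lincombˡ : ∀ N k M l P → N · (k ⊛ M ⊞ l ⊛ P) ≡ k ⊛ (N · M) ⊞ l ⊛ (N · P)
·-lincombˡ (mat n₁₁ n₁₂ n₂₁ n₂₂) k (mat m₁₁ m₁₂ m₂₁ m₂₂) l (mat p₁₁ p₁₂ p₂₁ p₂₂) = mat-cong
  (bilinear k l n₁₁ n₁₂ m₁₁ m₂₁ p₁₁ p₂₁) (bilinear k l n₁₁ n₁₂ m₁₂ m₂₂ p₁₂ p₂₂)
  (bilinear k l n₂₁ n₂₂ m₁₁ m₂₁ p₁₁ p₂₁) (bilinear k l n₂₁ n₂₂ m₁₂ m₂₂ p₁₂ p₂₂)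
  where
  bilinear : ∀ k l n n′ m m′ p p′ →
    n * (k * m + l * p) + n′ * (k * m′ + l * p′) ≡ k * (n * m + n′ * m′) + l * (n * p + n′ * p′)
  bilinear = solve-∀

∈C-𝟙 : ∀ N → N ∈C 𝟙
∈C-𝟙 (mat x y z w) = mat-cong (diagonal x z y) (offDiagonal y w x) (offDiagonal′ z x w) (diagonal′ w y z)
  where
  diagonal : ∀ u v s → 1ℤ * u + 0ℤ * v ≡ u * 1ℤ + s * 0ℤ
  diagonal = solve-∀
  offDiagonal : ∀ u v s → 1ℤ * u + 0ℤ * v ≡ s * 0ℤ + u * 1ℤ
  offDiagonal = solve-∀
  offDiagonal′ : ∀ u v s → 0ℤ * v + 1ℤ * u ≡ u * 1ℤ + s * 0ℤ
  offDiagonal′ = solve-∀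
  diagonal′ : ∀ u v s → 0ℤ * v + 1ℤ * u ≡ s * 0ℤ + u * 1ℤ
  diagonal′ = solve-∀

∈C-lincomb : ∀ {N M P} k l → N ∈C M → N ∈C P → N ∈C (k ⊛ M ⊞ l ⊛ P)
∈C-lincomb {N} {M} {P} k l N∈CM N∈CP = begin
  (k ⊛ M ⊞ l ⊛ P) · N      ≡⟨ ·-lincombʳ k M l P N ⟩
  k ⊛ (M · N) ⊞ l ⊛ (P · N) ≡⟨ cong₂ (λ X Y → k ⊛ X ⊞ l ⊛ Y) N∈CM N∈CP ⟩
  k ⊛ (N · M) ⊞ l ⊛ (N · P) ≡⟨ ·-lincombˡ N k M l P ⟨
  N · (k ⊛ M ⊞ l ⊛ P)      ∎
  where open ≡-Reasoning

∈C-lincomb-cancel : ∀ {N M P} k l .{{_ : NonZero k}} → N ∈C P → N ∈C (k ⊛ M ⊞ l ⊛ P) → N ∈C M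
∈C-lincomb-cancel {N} {M} {P} k l N∈CP N∈CA =
  ⊛-cancelˡ k (M · N) (N · M) (⊞-cancelʳ (k ⊛ (M · N)) (k ⊛ (N · M)) (l ⊛ (P · N)) (begin
    k ⊛ (M · N) ⊞ l ⊛ (P · N) ≡⟨ ·-lincombʳ k M l P N ⟨
    (k ⊛ M ⊞ l ⊛ P) · N      ≡⟨ N∈CA ⟩
    N · (k ⊛ M ⊞ l ⊛ P)      ≡⟨ ·-lincombˡ N k M l P ⟩
    k ⊛ (N · M) ⊞ l ⊛ (N · P) ≡⟨ cong (λ Y → k ⊛ (N · M) ⊞ l ⊛ Y) N∈CP ⟨
    k ⊛ (N · M) ⊞ l ⊛ (P · N) ∎))
  where open ≡-Reasoning

mat≡k⊛B⊞d⊛𝟙 : ∀ {a b c d} k x y z → a - d ≡ k * x → b ≡ k * y → c ≡ k * z →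
                mat a b c d ≡ k ⊛ mat x y z 0ℤ ⊞ d ⊛ 𝟙
mat≡k⊛B⊞d⊛𝟙 {a} {d = d} k x y z a-d≡kx refl refl =
  mat-cong (trans (shift a d) (cong (_+ d * 1ℤ) a-d≡kx)) (pad (k * y) d) (pad (k * z) d) (diagonal k d)
  where
  shift : ∀ a d → a ≡ a - d + d * 1ℤ
  shift = solve-∀
  pad : ∀ u d → u ≡ u + d * 0ℤ
  pad = solve-∀
  diagonal : ∀ k d → d ≡ k * 0ℤ + d * 1ℤ
  diagonal = solve-∀

+n*gcd[i,j]≡gcd[+n*i,+n*j] : ∀ n i j → + n * gcd i j ≡ gcd (+ n * i) (+ n * j)
+n*gcd[i,j]≡gcd[+n*i,+n*j] n i j = begin
  + n * gcd i j                           ≡⟨ pos-* n _ ⟨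
  + (n ℕ.* ℕ.gcd ∣ i ∣ ∣ j ∣)             ≡⟨ cong +_ (ℕ.c*gcd[m,n]≡gcd[cm,cn] n ∣ i ∣ ∣ j ∣) ⟩
  + ℕ.gcd (n ℕ.* ∣ i ∣) (n ℕ.* ∣ j ∣)     ≡⟨ cong₂ (λ u v → + ℕ.gcd u v) (abs-* (+ n) i) (abs-* (+ n) j) ⟨
  gcd (+ n * i) (+ n * j)                 ∎
  where open ≡-Reasoning

module Content (x y z : ℤ) where

  content : ℤ
  content = gcd (gcd x y) z

  private
    content∣gcd[x,y] : content ∣ gcd x y
    content∣gcd[x,y] = ∣ᵤ⇒∣ (gcd[i,j]∣i (gcd x y) z)

    content∣x : content ∣ x
    content∣x = ∣-trans content∣gcd[x,y] (∣ᵤ⇒∣ (gcd[i,j]∣i x y))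

    content∣y : content ∣ y
    content∣y = ∣-trans content∣gcd[x,y] (∣ᵤ⇒∣ (gcd[i,j]∣j x y))

    content∣z : content ∣ z
    content∣z = ∣ᵤ⇒∣ (gcd[i,j]∣j (gcd x y) z)

    content*quotient : ∀ {u} (content∣u : content ∣ u) → u ≡ content * quotient content∣u
    content*quotient content∣u =
      trans (Signed._∣_.equality content∣u) (*-comm (quotient content∣u) content)

  x′ y′ z′ : ℤ
  x′ = quotient content∣x
  y′ = quotient content∣y
  z′ = quotient content∣z

  x≡content*x′ : x ≡ content * x′
  x≡content*x′ = content*quotient content∣x

  y≡content*y′ : y ≡ content * y′
  y≡content*y′ = content*quotient content∣y

  z≡content*z′ : z ≡ content * z′
  z≡content*z′ = content*quotient content∣z

  content≡0⇒y≡0 : content ≡ 0ℤ → y ≡ 0ℤ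
  content≡0⇒y≡0 eq = gcd[i,j]≡0⇒j≡0 {x} (gcd[i,j]≡0⇒i≡0 (gcd x y) z eq)

  gcd[x′,y′,z′]≡1 : .{{_ : NonZero content}} → gcd (gcd x′ y′) z′ ≡ 1ℤ
  gcd[x′,y′,z′]≡1 = *-cancelˡ-≡ content _ _ (begin
    content * gcd (gcd x′ y′) z′
      ≡⟨ +n*gcd[i,j]≡gcd[+n*i,+n*j] ∣ content ∣ (gcd x′ y′) z′ ⟩
    gcd (content * gcd x′ y′) (content * z′)
      ≡⟨ cong (λ t → gcd t (content * z′)) (+n*gcd[i,j]≡gcd[+n*i,+n*j] ∣ content ∣ x′ y′) ⟩
    gcd (gcd (content * x′) (content * y′)) (content * z′)
      ≡⟨ cong₂ (λ u v → gcd (gcd u v) (content * z′)) x≡content*x′ y≡content*y′ ⟨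
    gcd (gcd x y) (content * z′)
      ≡⟨ cong (gcd (gcd x y)) z≡content*z′ ⟨
    content
      ≡⟨ *-identityʳ content ⟨
    content * 1ℤ
      ∎)
    where open ≡-Reasoning

  y′*z′≢0 : y * z ≢ 0ℤ → y′ * z′ ≢ 0ℤ
  y′*z′≢0 yz≢0 y′z′≡0 = yz≢0 (begin
    y * z                              ≡⟨ cong₂ _*_ y≡content*y′ z≡content*z′ ⟩
    content * y′ * (content * z′)      ≡⟨ interchange content y′ z′ ⟩
    content * content * (y′ * z′)      ≡⟨ cong (content * content *_) y′z′≡0 ⟩
    content * content * 0ℤ             ≡⟨ *-zeroʳ (content * content) ⟩
    0ℤ                                 ∎)
    where
    open ≡-Reasoning
    interchange : ∀ g u v → g * u * (g * v) ≡ g * g * (u * v)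
    interchange = solve-∀

lemma2p1 : (a b c d : ℤ) → b * c ≢ 0ℤ →
    Σ ℤ λ a₁ → Σ ℤ λ b₁ → Σ ℤ λ c₁ →
      (b₁ * c₁ ≢ 0ℤ) × (gcd (gcd a₁ b₁) c₁ ≡ 1ℤ) ×
      ((N : M₂ℤ) → ((N ∈C mat a b c d → N ∈C mat a₁ b₁ c₁ 0ℤ) × (N ∈C mat a₁ b₁ c₁ 0ℤ → N ∈C mat a b c d)))
lemma2p1 a b c d bc≢0 = a₁ , b₁ , c₁ , y′*z′≢0 bc≢0 , gcd[a₁,b₁,c₁]≡1 , λ N → C[A]⊆C[B] N , C[B]⊆C[A] N
  where
  open Content (a - d) b c renaming ( x′ to a₁; y′ to b₁; z′ to c₁
    ; x≡content*x′ to a-d≡content*a₁; y≡content*y′ to b≡content*b₁; z≡content*z′ to c≡content*c₁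
    ; gcd[x′,y′,z′]≡1 to gcd[a₁,b₁,c₁]≡1 )

  b≢0 : b ≢ 0ℤ
  b≢0 b≡0 = bc≢0 (cong (_* c) b≡0)

  instance
    content≢0 : NonZero content
    content≢0 = ≢-nonZero (λ content≡0 → b≢0 (content≡0⇒y≡0 content≡0))

  A≡content⊛B⊞d⊛𝟙 : mat a b c d ≡ content ⊛ mat a₁ b₁ c₁ 0ℤ ⊞ d ⊛ 𝟙
  A≡content⊛B⊞d⊛𝟙 = mat≡k⊛B⊞d⊛𝟙 content a₁ b₁ c₁ a-d≡content*a₁ b≡content*b₁ c≡content*c₁

  C[A]⊆C[B] : ∀ N → N ∈C mat a b c d → N ∈C mat a₁ b₁ c₁ 0ℤ
  C[A]⊆C[B] N N∈CA = ∈C-lincomb-cancel content d (∈C-𝟙 N) (subst (N ∈C_) A≡content⊛B⊞d⊛𝟙 N∈CA)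

  C[B]⊆C[A] : ∀ N → N ∈C mat a₁ b₁ c₁ 0ℤ → N ∈C mat a b c d
  C[B]⊆C[A] N N∈CB = subst (N ∈C_) (sym A≡content⊛B⊞d⊛𝟙) (∈C-lincomb content d N∈CB (∈C-𝟙 N))
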